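{- Let $p\in[n]^n$ be a parking preference. Then $p$ is a Motzkin parking function if and only if $\Phi(p)$ is a Motzkin path.
   Context: $[n]=\{1,\dots,n\}$. A parking function of length $n$ is $p\in[n]^n$ whose non-decreasing rearrangement $a_1\le\dots\le a_n$ satisfies $a_i\le i$ for all $i$ (equivalently, all cars manage to park in the classical or MVP parking process where car $i$ prefers spot $p_i$). A Motzkin parking function is a parking function in which, for every $j\in[n]$, $|\{i:p_i=j\}|\le 2$. For $p\in[n]^n$, $\Phi(p)=\phi_1\cdots\phi_n$ is the lattice path with steps $\phi_j=U=(1,1)$ if $|\{i:p_i=j\}|\ge2$, $\phi_j=H=(1,0)$ if $|\{i:p_i=j\}|=1$, and $\phi_j=D=(1,-1)$ if $|\{i:p_i=j\}|=0$. A Motzkin path of length $n$ is a lattice path from $(0,0)$ to $(n,0)$ with steps $U,H,D$ that never goes below the $x$-axis. -}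

module Defs where

open import Data.Nat using (ℕ; zero; suc; _≤_; _≟_)
open import Data.Nat.Properties using (≤-decTotalOrder)
open import Data.Fin using (Fin; toℕ)
open import Data.List using (List; []; _∷_; map; length; filter; allFin; upTo)
open import Data.Integer using (ℤ; +_; _+_; -[1+_]) renaming (_≤_ to _≤ℤ_)
open import Data.List.Relation.Unary.All using (All)
open import Data.Product using (_×_)
open import Data.Unit using (⊤)
open import Relation.Binary.PropositionalEquality using (_≡_)
open import Data.List.Sort.InsertionSort ≤-decTotalOrder using (sort)

-- A parking preference of length n: p ∈ [n]^n, written as a function
-- Fin n → ℕ (car i prefers spot p i), with the constraint 1 ≤ p i ≤ n.
InRange : (n : ℕ) → (Fin n → ℕ) → Set
InRange n p = (i : Fin n) → (1 ≤ p i) × (p i ≤ n)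

prefs : (n : ℕ) → (Fin n → ℕ) → List ℕ
prefs n p = map p (allFin n)

rearr : (n : ℕ) → (Fin n → ℕ) → List ℕ
rearr n p = sort (prefs n p)

BoundedFrom : ℕ → List ℕ → Set
BoundedFrom i [] = ⊤
BoundedFrom i (a ∷ as) = (a ≤ i) × BoundedFrom (suc i) as

IsParkingFunction : (n : ℕ) → (Fin n → ℕ) → Set
IsParkingFunction n p = BoundedFrom 1 (rearr n p)

count : (n : ℕ) → (Fin n → ℕ) → ℕ → ℕ
count n p j = length (filter (λ i → p i ≟ j) (allFin n))

IsMotzkinPF : (n : ℕ) → (Fin n → ℕ) → Set
IsMotzkinPF n p = IsParkingFunction n p × ((j : ℕ) → 1 ≤ j → j ≤ n → count n p j ≤ 2)

data Step : Set where
  U H D : Step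

stepOf : ℕ → Step
stepOf zero = D
stepOf (suc zero) = H
stepOf (suc (suc _)) = U

Φ : (n : ℕ) → (Fin n → ℕ) → List Step
Φ n p = map (λ k → stepOf (count n p (suc k))) (upTo n)

height : Step → ℤ
height U = + 1
height H = + 0
height D = -[1+ 0 ]

heights : ℤ → List Step → List ℤ
heights h [] = []
heights h (s ∷ ss) = (h + height s) ∷ heights (h + height s) ss

endHeight : ℤ → List Step → ℤ
endHeight h [] = h
endHeight h (s ∷ ss) = endHeight (h + height s) ss

IsMotzkinPath : List Step → Set
IsMotzkinPath w = All (λ y → + 0 ≤ℤ y) (heights (+ 0) w) × (endHeight (+ 0) w ≡ + 0)

-- Sort the preferences: the sorted list is determined by the multiplicities c₁, …, cₙ of the spots,
-- which sum to n. The parking condition aᵢ ≤ i says that for every j at least j cars prefer one of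
-- the spots 1, …, j, i.e. that the partial sums of cₖ − 1 stay non-negative. Φ(p) takes steps of
-- height min(cₖ, 2) − 1, so when all cₖ ≤ 2 its heights are exactly these partial sums; if some
-- cₖ ≥ 3 the path undercounts the cars and ends below 0, since the cₖ − 1 sum to 0.
module Submission where

open import Defs
open import Data.Nat using (ℕ; zero; suc; _+_; _≤_; _<_; _≟_; z≤n; s≤s)
open import Data.Nat.Properties
open import Data.Nat.ListAction using (sum)
open import Data.Fin using (Fin)
open import Data.Integer using (ℤ; +_; +≤+) renaming (_+_ to _+ℤ_; _≤_ to _≤ℤ_)
open import Data.Integer.Properties using (+-injective)
open import Data.List using (List; []; _∷_; map; length; filter; allFin; upTo; applyUpTo; replicate; _++_)
open import Data.List.Properties
  using (filter-accept; filter-reject; length-map; length-tabulate; length-++; length-replicate;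
         length-applyUpTo; map-upTo; map-applyUpTo; map-cong)
open import Data.List.Relation.Unary.All as All using (All; []; _∷_)
open import Data.List.Relation.Unary.All.Properties using (++⁻ʳ; map⁺; applyUpTo⁺₁; applyUpTo⁻)
open import Data.List.Relation.Unary.Linked as Linked using (Linked; []; _∷_)
open import Data.List.Relation.Unary.Linked.Properties using (Linked⇒All)
open import Data.List.Relation.Binary.Permutation.Propositional using (_↭_; ↭-sym)
open import Data.List.Relation.Binary.Permutation.Propositional.Properties using (↭-length; filter-↭; All-resp-↭)
open import Data.List.Sort.InsertionSort ≤-decTotalOrder using (sort)
open import Data.List.Sort.InsertionSort.Properties ≤-decTotalOrder using (sort-↭; sort-↗)
open import Data.Product using (_×_; _,_; proj₁; proj₂; ∃)
open import Data.Product.Function.NonDependent.Propositional using (_×-⇔_)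
open import Data.Unit using (tt)
open import Data.Empty using (⊥; ⊥-elim)
open import Relation.Nullary using (yes; no; ¬_)
open import Relation.Binary.PropositionalEquality
open import Function using (_∘_)
open import Function.Bundles using (_⇔_; mk⇔; Equivalence)
open import Function.Related.Propositional using (equivalence; ≡⇒; module EquationalReasoning)

occurrences : ℕ → List ℕ → ℕ
occurrences j xs = length (filter (_≟ j) xs)

occurrences-map : ∀ {A : Set} (f : A → ℕ) j xs →
  length (filter (λ x → f x ≟ j) xs) ≡ occurrences j (map f xs)
occurrences-map f j [] = refl
occurrences-map f j (x ∷ xs) with f x ≟ j
... | yes fx≡j = begin
  length (filter (λ x → f x ≟ j) (x ∷ xs)) ≡⟨ cong length (filter-accept (λ x → f x ≟ j) fx≡j) ⟩
  suc (length (filter (λ x → f x ≟ j) xs)) ≡⟨ cong suc (occurrences-map f j xs) ⟩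
  suc (occurrences j (map f xs))           ≡⟨ cong length (filter-accept (_≟ j) fx≡j) ⟨
  occurrences j (map f (x ∷ xs))           ∎
  where open ≡-Reasoning
... | no fx≢j = begin
  length (filter (λ x → f x ≟ j) (x ∷ xs)) ≡⟨ cong length (filter-reject (λ x → f x ≟ j) fx≢j) ⟩
  length (filter (λ x → f x ≟ j) xs)       ≡⟨ occurrences-map f j xs ⟩
  occurrences j (map f xs)                 ≡⟨ cong length (filter-reject (_≟ j) fx≢j) ⟨
  occurrences j (map f (x ∷ xs))           ∎
  where open ≡-Reasoning

occurrences-↭ : ∀ j {xs ys} → xs ↭ ys → occurrences j xs ≡ occurrences j ys
occurrences-↭ j = ↭-length ∘ filter-↭ (_≟ j)

occurrences-replicate-++ : ∀ {x j} c L → j ≢ x → occurrences x (replicate c j ++ L) ≡ occurrences x L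
occurrences-replicate-++ zero    L j≢x = refl
occurrences-replicate-++ (suc c) L j≢x =
  trans (cong length (filter-reject (_≟ _) j≢x)) (occurrences-replicate-++ c L j≢x)

occurrences-head : ∀ j xs → occurrences j (j ∷ xs) ≡ suc (occurrences j xs)
occurrences-head j xs = cong length (filter-accept (_≟ j) refl)

occurrences-absent : ∀ j {L} → All (j <_) L → occurrences j L ≡ 0
occurrences-absent j []            = refl
occurrences-absent j (j<x ∷ j<xs) =
  trans (cong length (filter-reject (_≟ j) (>⇒≢ j<x))) (occurrences-absent j j<xs)

runs : ℕ → List ℕ → List ℕ
runs j []       = []
runs j (c ∷ cs) = replicate c j ++ runs (suc j) cs

length-runs : ∀ j cs → length (runs j cs) ≡ sum cs
length-runs j []       = refl
length-runs j (c ∷ cs) = begin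
  length (replicate c j ++ runs (suc j) cs)         ≡⟨ length-++ (replicate c j) ⟩
  length (replicate c j) + length (runs (suc j) cs) ≡⟨ cong₂ _+_ (length-replicate c) (length-runs (suc j) cs) ⟩
  c + sum cs                                        ∎
  where open ≡-Reasoning

applyUpTo-cong : ∀ {A : Set} {f g : ℕ → A} → (∀ k → f k ≡ g k) → ∀ m → applyUpTo f m ≡ applyUpTo g m
applyUpTo-cong {f = f} {g} f≗g m =
  trans (sym (map-upTo f m)) (trans (map-cong f≗g (upTo m)) (map-upTo g m))

sorted-split-minimum : ∀ j {L} → Linked _≤_ L → All (j ≤_) L →
  ∃ λ L' → L ≡ replicate (occurrences j L) j ++ L' × Linked _≤_ L' × All (j <_) L'
sorted-split-minimum j [] [] = [] , refl , [] , []
sorted-split-minimum j {x ∷ xs} sorted (j≤x ∷ j≤xs) with x ≟ j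
... | yes refl
  with L' , xs≡ , sorted' , j<L' ← sorted-split-minimum x (Linked.tail sorted) j≤xs
  = L' , trans (cong (x ∷_) xs≡) (cong (λ c → replicate c x ++ L') (sym (occurrences-head x xs))) , sorted' , j<L'
... | no x≢j =
  x ∷ xs , cong (λ c → replicate c j ++ x ∷ xs) (sym (occurrences-absent j j<x∷xs)) , sorted , j<x∷xs
  where
  j<x∷xs : All (j <_) (x ∷ xs)
  j<x∷xs = Linked⇒All ≤-trans (≤∧≢⇒< j≤x (x≢j ∘ sym)) sorted

sorted≡runs : ∀ m j {L} → Linked _≤_ L → All (λ x → j ≤ x × x < j + m) L →
  L ≡ runs j (applyUpTo (λ k → occurrences (j + k) L) m)
sorted≡runs zero    j _ [] = refl
sorted≡runs zero    j _ ((j≤x , x<j+0) ∷ _) = ⊥-elim (<⇒≱ x<j+0 (≤-trans (≤-reflexive (+-identityʳ j)) j≤x))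
sorted≡runs (suc m) j {L} sorted bounds
  with L' , L≡ , sorted' , j<L' ← sorted-split-minimum j sorted (All.map proj₁ bounds) = begin
    L                                         ≡⟨ L≡ ⟩
    replicate (occurrences j L) j ++ L'       ≡⟨ cong₂ (λ c rest → replicate c j ++ rest)
                                                       (cong (λ i → occurrences i L) (sym (+-identityʳ j))) L'≡ ⟩
    runs j (applyUpTo (λ k → occurrences (j + k) L) (suc m)) ∎
  where
  open ≡-Reasoning
  bounds' : All (λ x → suc j ≤ x × x < suc j + m) L'
  bounds' = All.zipWith (λ (j<x , (_ , x<)) → j<x , <-≤-trans x< (≤-reflexive (+-suc j m)))
                        (j<L' , ++⁻ʳ (replicate (occurrences j L) j) (subst (All _) L≡ bounds))
  same-occurrences : ∀ k → occurrences (suc j + k) L' ≡ occurrences (j + suc k) L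
  same-occurrences k = begin
    occurrences (suc j + k) L'
      ≡⟨ occurrences-replicate-++ (occurrences j L) L' (<⇒≢ (s≤s (m≤m+n j k))) ⟨
    occurrences (suc j + k) (replicate (occurrences j L) j ++ L')
      ≡⟨ cong (occurrences (suc j + k)) L≡ ⟨
    occurrences (suc j + k) L
      ≡⟨ cong (λ i → occurrences i L) (+-suc j k) ⟨
    occurrences (j + suc k) L
      ∎
  L'≡ : L' ≡ runs (suc j) (applyUpTo (λ k → occurrences (j + suc k) L) m)
  L'≡ = trans (sorted≡runs m (suc j) sorted' bounds') (cong (runs (suc j)) (applyUpTo-cong same-occurrences m))

MotzkinSuffix : ℕ → List Step → Set
MotzkinSuffix h       []      = h ≡ 0
MotzkinSuffix h       (U ∷ w) = MotzkinSuffix (suc h) w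
MotzkinSuffix h       (H ∷ w) = MotzkinSuffix h w
MotzkinSuffix zero    (D ∷ w) = ⊥
MotzkinSuffix (suc h) (D ∷ w) = MotzkinSuffix h w

IsMotzkinPathFrom : ℤ → List Step → Set
IsMotzkinPathFrom z w = All (λ y → + 0 ≤ℤ y) (heights z w) × (endHeight z w ≡ + 0)

+-height-U : ∀ h → + h +ℤ height U ≡ + suc h
+-height-U h = cong +_ (+-comm h 1)

+-height-H : ∀ h → + h +ℤ height H ≡ + h
+-height-H h = cong +_ (+-identityʳ h)

MotzkinSuffix⇔IsMotzkinPathFrom : ∀ h w → MotzkinSuffix h w ⇔ IsMotzkinPathFrom (+ h) w
MotzkinSuffix⇔IsMotzkinPathFrom h w = mk⇔ (to h w) (from h w)
  where
  to : ∀ h w → MotzkinSuffix h w → IsMotzkinPathFrom (+ h) w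
  to h       []      h≡0 = [] , cong +_ h≡0
  to h       (U ∷ w) m
    with above , ends ← subst (λ z → IsMotzkinPathFrom z w) (sym (+-height-U h)) (to (suc h) w m)
    = +≤+ z≤n ∷ above , ends
  to h       (H ∷ w) m
    with above , ends ← subst (λ z → IsMotzkinPathFrom z w) (sym (+-height-H h)) (to h w m)
    = +≤+ z≤n ∷ above , ends
  to zero    (D ∷ w) ()
  to (suc h) (D ∷ w) m
    with above , ends ← to h w m
    = +≤+ z≤n ∷ above , ends
  from : ∀ h w → IsMotzkinPathFrom (+ h) w → MotzkinSuffix h w
  from h       []      (_ , h≡0)          = +-injective h≡0
  from h       (U ∷ w) (_ ∷ above , ends) =
    from (suc h) w (subst (λ z → IsMotzkinPathFrom z w) (+-height-U h) (above , ends))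
  from h       (H ∷ w) (_ ∷ above , ends) =
    from h w (subst (λ z → IsMotzkinPathFrom z w) (+-height-H h) (above , ends))
  from zero    (D ∷ w) (() ∷ _ , _)
  from (suc h) (D ∷ w) (_ ∷ above , ends) = from h w (above , ends)

MotzkinSuffix-length≤ : ∀ h cs → MotzkinSuffix h (map stepOf cs) → length cs ≤ h + sum cs
MotzkinSuffix-length≤ h       []                 _ = z≤n
MotzkinSuffix-length≤ (suc h) (zero ∷ cs)        m = s≤s (MotzkinSuffix-length≤ h cs m)
MotzkinSuffix-length≤ h       (suc zero ∷ cs)    m = begin
  suc (length cs)    ≤⟨ s≤s (MotzkinSuffix-length≤ h cs m) ⟩
  suc (h + sum cs)   ≡⟨ +-suc h (sum cs) ⟨
  h + suc (sum cs)   ∎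
  where open ≤-Reasoning
MotzkinSuffix-length≤ h       (suc (suc c) ∷ cs) m = begin
  suc (length cs)                  ≤⟨ s≤s (MotzkinSuffix-length≤ (suc h) cs m) ⟩
  suc (suc (h + sum cs))           ≤⟨ s≤s (s≤s (+-monoʳ-≤ h (m≤n+m (sum cs) c))) ⟩
  suc (suc (h + (c + sum cs)))     ≡⟨ cong suc (+-suc h (c + sum cs)) ⟨
  suc (h + suc (c + sum cs))       ≡⟨ +-suc h (suc (c + sum cs)) ⟨
  h + suc (suc (c + sum cs))       ∎
  where open ≤-Reasoning

BoundedFrom-runs-below : ∀ {i j} cs → i < j → BoundedFrom i (runs j cs) → sum cs ≡ 0
BoundedFrom-runs-below []           i<j _           = refl
BoundedFrom-runs-below (zero ∷ cs)  i<j bounded     = BoundedFrom-runs-below cs (m≤n⇒m≤1+n i<j) bounded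
BoundedFrom-runs-below (suc c ∷ cs) i<j (j≤i , _)   = ⊥-elim (<⇒≱ i<j j≤i)

¬MotzkinSuffix-≥3 : ∀ c cs h → sum (3 + c ∷ cs) + h ≡ length (3 + c ∷ cs) →
  ¬ MotzkinSuffix h (map stepOf (3 + c ∷ cs))
¬MotzkinSuffix-≥3 c cs h balanced m = <-irrefl refl (begin-strict
  suc (sum cs + h)       ≤⟨ s≤s (+-monoˡ-≤ h (m≤n+m (sum cs) c)) ⟩
  suc (c + sum cs + h)   <⟨ ≤-reflexive (suc-injective balanced) ⟩
  length cs              ≤⟨ MotzkinSuffix-length≤ (suc h) cs m ⟩
  suc h + sum cs         ≡⟨ cong suc (+-comm h (sum cs)) ⟩
  suc (sum cs + h)       ∎)
  where open ≤-Reasoning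

-- j + h is the position of the first car preferring a spot ≥ j, so h (cars preferring a spot < j,
-- minus the j − 1 spots below j) is the height the path has reached after j − 1 steps.
BoundedFrom-runs⇔MotzkinSuffix : ∀ cs j h → sum cs + h ≡ length cs →
  (BoundedFrom (j + h) (runs j cs) × All (_≤ 2) cs) ⇔ MotzkinSuffix h (map stepOf cs)
BoundedFrom-runs⇔MotzkinSuffix [] j h h≡0 = mk⇔ (λ _ → h≡0) (λ _ → tt , [])
BoundedFrom-runs⇔MotzkinSuffix (zero ∷ cs) j zero balanced = mk⇔ contradiction λ ()
  where
  contradiction : BoundedFrom (j + 0) (runs (suc j) cs) × All (_≤ 2) (0 ∷ cs) → ⊥
  contradiction (bounded , _) =
    0≢1+n (trans (sym (BoundedFrom-runs-below cs (s≤s (≤-reflexive (+-identityʳ j))) bounded))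
                 (trans (sym (+-identityʳ (sum cs))) balanced))
BoundedFrom-runs⇔MotzkinSuffix (zero ∷ cs) j (suc h) balanced =
  mk⇔ (λ { (bounded , _ ∷ ≤2) → to (reindex (+-suc j h) bounded , ≤2) })
      (λ m → let bounded , ≤2 = from m in reindex (sym (+-suc j h)) bounded , z≤n ∷ ≤2)
  where
  open Equivalence (BoundedFrom-runs⇔MotzkinSuffix cs (suc j) h
                      (suc-injective (trans (sym (+-suc (sum cs) h)) balanced)))
  reindex : ∀ {i i'} → i ≡ i' → BoundedFrom i (runs (suc j) cs) → BoundedFrom i' (runs (suc j) cs)
  reindex = subst (λ i → BoundedFrom i (runs (suc j) cs))
BoundedFrom-runs⇔MotzkinSuffix (suc zero ∷ cs) j h balanced =
  mk⇔ (λ { ((_ , bounded) , _ ∷ ≤2) → to (bounded , ≤2) })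
      (λ m → let bounded , ≤2 = from m in (m≤m+n j h , bounded) , s≤s z≤n ∷ ≤2)
  where open Equivalence (BoundedFrom-runs⇔MotzkinSuffix cs (suc j) h (suc-injective balanced))
BoundedFrom-runs⇔MotzkinSuffix (suc (suc zero) ∷ cs) j h balanced =
  mk⇔ (λ { ((_ , _ , bounded) , _ ∷ ≤2) → to (reindex (sym 2+j+h≡) bounded , ≤2) })
      (λ m → let bounded , ≤2 = from m in
               (j≤j+h , m≤n⇒m≤1+n j≤j+h , reindex 2+j+h≡ bounded) , s≤s (s≤s z≤n) ∷ ≤2)
  where
  open Equivalence (BoundedFrom-runs⇔MotzkinSuffix cs (suc j) (suc h)
                      (trans (+-suc (sum cs) h) (suc-injective balanced)))
  j≤j+h : j ≤ j + h
  j≤j+h = m≤m+n j h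
  2+j+h≡ : suc j + suc h ≡ suc (suc (j + h))
  2+j+h≡ = cong suc (+-suc j h)
  reindex : ∀ {i i'} → i ≡ i' → BoundedFrom i (runs (suc j) cs) → BoundedFrom i' (runs (suc j) cs)
  reindex = subst (λ i → BoundedFrom i (runs (suc j) cs))
BoundedFrom-runs⇔MotzkinSuffix (suc (suc (suc c)) ∷ cs) j h balanced =
  mk⇔ (λ { (_ , s≤s (s≤s ()) ∷ _) }) (⊥-elim ∘ ¬MotzkinSuffix-≥3 c cs h balanced)

All-applyUpTo-suc⇔ : ∀ (P : ℕ → Set) (f : ℕ → ℕ) n →
  (∀ j → 1 ≤ j → j ≤ n → P (f j)) ⇔ All P (applyUpTo (f ∘ suc) n)
All-applyUpTo-suc⇔ P f n =
  mk⇔ (λ P[f] → applyUpTo⁺₁ (f ∘ suc) n (P[f] _ (s≤s z≤n)))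
      (λ { all (suc k) _ k<n → applyUpTo⁻ (f ∘ suc) n all k<n })

multiplicities : (n : ℕ) → (Fin n → ℕ) → List ℕ
multiplicities n p = applyUpTo (λ k → count n p (suc k)) n

Φ≡map-stepOf-multiplicities : ∀ n p → Φ n p ≡ map stepOf (multiplicities n p)
Φ≡map-stepOf-multiplicities n p = trans (map-upTo _ n) (sym (map-applyUpTo _ stepOf n))

rearr≡runs-multiplicities : ∀ n p → InRange n p → rearr n p ≡ runs 1 (multiplicities n p)
rearr≡runs-multiplicities n p inRange =
  trans (sorted≡runs n 1 (sort-↗ (prefs n p)) bounds)
        (cong (runs 1) (applyUpTo-cong (sym ∘ count≡occurrences ∘ suc) n))
  where
  rearr↭prefs : rearr n p ↭ prefs n p
  rearr↭prefs = sort-↭ (prefs n p)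
  count≡occurrences : ∀ j → count n p j ≡ occurrences j (rearr n p)
  count≡occurrences j = trans (occurrences-map p j (allFin n)) (sym (occurrences-↭ j rearr↭prefs))
  bounds : All (λ x → 1 ≤ x × x < 1 + n) (rearr n p)
  bounds = All-resp-↭ (↭-sym rearr↭prefs)
             (map⁺ (All.universal (λ i → proj₁ (inRange i) , s≤s (proj₂ (inRange i))) (allFin n)))

sum-multiplicities : ∀ n p → InRange n p → sum (multiplicities n p) ≡ n
sum-multiplicities n p inRange = begin
  sum (multiplicities n p)                  ≡⟨ length-runs 1 (multiplicities n p) ⟨
  length (runs 1 (multiplicities n p))      ≡⟨ cong length (rearr≡runs-multiplicities n p inRange) ⟨
  length (sort (prefs n p))                 ≡⟨ ↭-length (sort-↭ (prefs n p)) ⟩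
  length (map p (allFin n))                 ≡⟨ length-map p (allFin n) ⟩
  length (allFin n)                         ≡⟨ length-tabulate (λ i → i) ⟩
  n                                         ∎
  where open ≡-Reasoning

theorem3p2 : (n : ℕ) (p : Fin n → ℕ) → InRange n p →
    IsMotzkinPF n p ⇔ IsMotzkinPath (Φ n p)
theorem3p2 n p inRange = begin
  IsMotzkinPF n p
    ∼⟨ ≡⇒ (cong (BoundedFrom 1) (rearr≡runs-multiplicities n p inRange))
       ×-⇔ All-applyUpTo-suc⇔ (_≤ 2) (count n p) n ⟩
  (BoundedFrom 1 (runs 1 cs) × All (_≤ 2) cs)
    ∼⟨ BoundedFrom-runs⇔MotzkinSuffix cs 1 0 balanced ⟩
  MotzkinSuffix 0 (map stepOf cs)
    ∼⟨ MotzkinSuffix⇔IsMotzkinPathFrom 0 (map stepOf cs) ⟩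
  IsMotzkinPath (map stepOf cs)
    ≡⟨ cong IsMotzkinPath (Φ≡map-stepOf-multiplicities n p) ⟨
  IsMotzkinPath (Φ n p)
    ∎
  where
  open EquationalReasoning {k = equivalence}
  cs : List ℕ
  cs = multiplicities n p
  balanced : sum cs + 0 ≡ length cs
  balanced = trans (+-identityʳ (sum cs)) (trans (sum-multiplicities n p inRange) (sym (length-applyUpTo _ n)))
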